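{- Let $P$ be a finite bounded poset with $|P|>1$, let $\omega$ be an admissible map on $P$ (see context), and let $r$ be a rational number with $0\le r<1$. (i) If $A$ is a nontrivial antichain in $P$, then $\mathbf{I}_r(P,A;\omega)=\bigcap_{a\in A}\mathbf{I}_r(P,a;\omega)$. (ii) If $A'$ and $A''$ are antichains in $P$ with $A'\le A''$ in $\mathfrak{A}_{\triangledown}(P)$, then $\mathbf{I}_r(P,A';\omega)\supseteq\mathbf{I}_r(P,A'';\omega)$. (iii) If $r',r''$ are rationals with $0\le r'\le r''<1$, then for every antichain $A$ in $P$, $\mathbf{I}_{r'}(P,A;\omega)\supseteq\mathbf{I}_{r''}(P,A;\omega)$.
   Context: $P$ is a finite poset with least element $\hat0_P$ and greatest element $\hat1_P$, $|P|>1$. For $A\subseteq P$, $\mathfrak I(A)=\{p\in P: p\le a\text{ for some }a\in A\}$ and $\mathfrak F(A)=\{p\in P: p\ge a\text{ for some }a\in A\}$; $\mathfrak I(b):=\mathfrak I(\{b\})$. For $Q\subseteq P$, $\min Q$ and $\max Q$ denote the sets of minimal and maximal elements of $Q$. $\mathfrak{A}_{\vartriangle}(P)$ is the set of all antichains of $P$ (including the empty one) ordered by $A'\le A''$ iff $\mathfrak I(A')\subseteq\mathfrak I(A'')$; its meet is $A'\wedge_{\vartriangle}A''=\max(\mathfrak I(A')\cap\mathfrak I(A''))$. $\mathfrak{A}_{\triangledown}(P)$ is the set of all antichains ordered by $A'\le A''$ iff $\mathfrak F(A')\subseteq\mathfrak F(A'')$; its least element is the empty antichain and its greatest element is $\{\hat0_P\}$.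 These two antichains are called trivial; all other antichains are nontrivial. An admissible map is a map $\omega:\mathfrak{A}_{\vartriangle}(P)\to\{ -1\}\cup\mathbb N$ with $\omega(\emptyset)=-1$, $\omega(\{\hat0_P\})=0$, and $0<\omega(A')\le\omega(A'')$ whenever $\{\hat0_P\}<A'\le A''$ in $\mathfrak{A}_{\vartriangle}(P)$; write $\omega(b):=\omega(\{b\})$. Relatively $r$-blocking elements: for a subset $A\subseteq P$ that is nonempty and $\ne\{\hat0_P\}$, an element $b\in P\setminus\{\hat0_P\}$ is relatively $r$-blocking for $A$ (w.r.t. $\omega$) if $\omega(\{b\}\wedge_{\vartriangle}\{a\})/\omega(b)>r$ for every $a\in A\setminus\{\hat0_P\}$; the set $\{\hat0_P\}$ has no relatively $r$-blocking elements; every element of $P$ is relatively $r$-blocking for $A=\emptyset$. $\mathbf{I}_r(P,A;\omega)$ denotes the set of relatively $r$-blocking elements for $A$, and $\mathbf{I}_r(P,a;\omega):=\mathbf{I}_r(P,\{a\};\omega)$. -}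

module Defs where

open import Level using (0ℓ)
open import Data.Nat as ℕ using (ℕ; suc)
open import Data.Integer as ℤ using (ℤ; +_; -[1+_])
open import Data.Rational as ℚ using (ℚ)
open import Data.Fin using (Fin)
open import Data.Fin.Subset using (Subset; _∈_; _∩_; _⊆_; ⁅_⁆; ⊥; outside; inside)
open import Data.Fin.Subset.Properties using (_∈?_)
open import Data.Fin.Properties using (any?; all?)
open import Data.Vec using (tabulate)
open import Data.Product using (_×_; ∃)
open import Data.Sum using (_⊎_)
open import Relation.Nullary using (¬_; Dec; does)
open import Relation.Nullary.Decidable using (_×-dec_; ¬?)
open import Relation.Binary using (IsPartialOrder; Decidable)
open import Relation.Binary.PropositionalEquality using (_≡_; _≢_)
open import Data.Fin.Properties using (_≟_)

record FinBoundedPoset (n : ℕ) : Set₁ where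
  field
    _≼_            : Fin n → Fin n → Set
    isPartialOrder : IsPartialOrder _≡_ _≼_
    _≼?_           : Decidable _≼_
    𝟘 𝟙            : Fin n
    𝟘-least        : ∀ p → 𝟘 ≼ p
    𝟙-greatest     : ∀ p → p ≼ 𝟙

-- total division ℤ × ℤ → ℚ (convention x/0 = 0; only used with positive denominators)
_/ℤ_ : ℤ → ℤ → ℚ
x /ℤ (+ 0)       = ℚ.0ℚ
x /ℤ (+ (suc d)) = x ℚ./ suc d
x /ℤ -[1+ d ]    = ℚ.- (x ℚ./ suc d)

module _ {n : ℕ} (P : FinBoundedPoset n) where
  open FinBoundedPoset P

  ideal : Subset n → Subset n
  ideal A = tabulate (λ p → does (any? (λ a → (a ∈? A) ×-dec (p ≼? a))))

  filter : Subset n → Subset n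
  filter A = tabulate (λ p → does (any? (λ a → (a ∈? A) ×-dec (a ≼? p))))

  maxOf : Subset n → Subset n
  maxOf Q = tabulate (λ p → does ((p ∈? Q) ×-dec
              all? (λ q → ¬? ((q ∈? Q) ×-dec ((p ≼? q) ×-dec ¬? (p ≟ q))))))

  IsAntichain : Subset n → Set
  IsAntichain A = ∀ a b → a ∈ A → b ∈ A → a ≼ b → a ≡ b

  _≤△_ : Subset n → Subset n → Set
  A′ ≤△ A″ = ideal A′ ⊆ ideal A″

  _≤▽_ : Subset n → Subset n → Set
  A′ ≤▽ A″ = filter A′ ⊆ filter A″

  _∧△_ : Subset n → Subset n → Subset n
  A′ ∧△ A″ = maxOf (ideal A′ ∩ ideal A″)

  -- admissible maps (given on all subsets; only values on antichains are constrained/used)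
  record Admissible (ω : Subset n → ℤ) : Set where
    field
      ω-empty : ω ⊥ ≡ -[1+ 0 ]
      ω-zero  : ω ⁅ 𝟘 ⁆ ≡ + 0
      ω-mono  : ∀ A′ A″ → IsAntichain A′ → IsAntichain A″ →
                ⁅ 𝟘 ⁆ ≤△ A′ → A′ ≢ ⁅ 𝟘 ⁆ → A′ ≤△ A″ →
                (+ 0 ℤ.< ω A′) × (ω A′ ℤ.≤ ω A″)

  RelBlocking : (ω : Subset n → ℤ) → ℚ → Subset n → Fin n → Set
  RelBlocking ω r A b =
    (A ≡ ⊥) ⊎
    (A ≢ ⊥ × A ≢ ⁅ 𝟘 ⁆ × b ≢ 𝟘 ×
      (∀ a → a ∈ A → a ≢ 𝟘 → r ℚ.< (ω (⁅ b ⁆ ∧△ ⁅ a ⁆) /ℤ ω ⁅ b ⁆)))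

-- For a nontrivial antichain A, b is relatively r-blocking exactly when b ≠ 0̂ and
-- r < ω({b} ∧ {a}) / ω(b) for every a ∈ A; reading this for A and for each {a} gives (i).
-- For (ii), every a ∈ A′ lies above some a″ ∈ A″, and {b} ∧ {a} grows with a in 𝔄_△(P),
-- so admissibility makes the ratio at a at least the ratio at a″.  Admissible maps are
-- only monotone strictly above {0̂}; because r ≥ 0, a ratio exceeding r has a positive
-- numerator, which excludes the meets ∅ and {0̂}.
module Submission where

open import Defs
open import Data.Nat as ℕ using (ℕ; suc)
open import Data.Integer as ℤ using (ℤ; +_)
import Data.Integer.Properties as ℤₚ
open import Data.Rational as ℚ using (ℚ)
import Data.Rational.Properties as ℚₚ
open import Data.Rational.Unnormalised as ℚᵘ using (mkℚᵘ)
import Data.Rational.Unnormalised.Properties as ℚᵘₚ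
open import Data.Fin using (Fin)
open import Data.Fin.Properties using (any?; all?; _≟_)
open import Data.Fin.Induction using (po-noetherian)
open import Data.Fin.Subset using (Subset; _∈_; _⊆_; ⁅_⁆; ⊥)
open import Data.Fin.Subset.Properties
  using ( _∈?_; x∈⁅x⁆; x∈⁅y⁆⇒x≡y; ∉⊥; Empty-unique; nonempty?; ⊆-refl; ⊆-antisym
        ; x∈p∩q⁺; x∈p∩q⁻)
open import Data.Vec using (tabulate)
open import Data.Vec.Properties using (lookup∘tabulate; []=⇒lookup; lookup⇒[]=)
open import Data.Product using (_×_; _,_; ∃-syntax; proj₁; proj₂)
open import Data.Sum using (inj₁; inj₂)
open import Function using (_∘_)
open import Function.Bundles using (_⇔_; mk⇔; Equivalence)
open import Induction.WellFounded using (Acc; acc)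
open import Relation.Binary using (IsPartialOrder)
open import Relation.Binary.PropositionalEquality using (_≡_; _≢_; refl; sym; trans; subst)
open import Relation.Nullary using (¬_; yes; no; does; contradiction)
open import Relation.Nullary.Decidable using (_×-dec_; ¬?; dec-true)
open import Relation.Unary using (Decidable)

fromℚᵘ-mono-≤ : ∀ {p q} → p ℚᵘ.≤ q → ℚ.fromℚᵘ p ℚ.≤ ℚ.fromℚᵘ q
fromℚᵘ-mono-≤ {p} {q} p≤q = ℚₚ.toℚᵘ-cancel-≤
  (ℚᵘₚ.≤-respˡ-≃ (ℚᵘₚ.≃-sym (ℚₚ.toℚᵘ-fromℚᵘ p))
    (ℚᵘₚ.≤-respʳ-≃ (ℚᵘₚ.≃-sym (ℚₚ.toℚᵘ-fromℚᵘ q)) p≤q))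

-- For d > 0, x /ℤ d unfolds to fromℚᵘ (mkℚᵘ x (d - 1)), so these are read off in ℚᵘ.
/ℤ-monoˡ-≤ : ∀ {d x y} → + 0 ℤ.< d → x ℤ.≤ y → x /ℤ d ℚ.≤ y /ℤ d
/ℤ-monoˡ-≤ {+ 0}     (ℤ.+<+ ())
/ℤ-monoˡ-≤ {+ suc k} {x} {y} _ x≤y =
  fromℚᵘ-mono-≤ {mkℚᵘ x k} {mkℚᵘ y k} (ℚᵘ.*≤* (ℤₚ.*-monoʳ-≤-nonNeg (+ suc k) x≤y))

/ℤ-pos⁻¹ : ∀ {d x} → + 0 ℤ.< d → ℚ.0ℚ ℚ.< x /ℤ d → + 0 ℤ.< x
/ℤ-pos⁻¹ {+ 0}     (ℤ.+<+ ())
/ℤ-pos⁻¹ {+ suc k} {x} _ 0<x/d = ℤₚ.positive⁻¹ x {{ℚᵘ.positive 0<x}}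
  where
  0<x = ℚᵘₚ.<-respʳ-≃ (ℚₚ.toℚᵘ-fromℚᵘ (mkℚᵘ x k)) (ℚₚ.toℚᵘ-mono-< 0<x/d)

module _ {n : ℕ} {Q : Fin n → Set} (Q? : Decidable Q) where

  ∈-tabulate-does⁺ : ∀ {x} → Q x → x ∈ tabulate (does ∘ Q?)
  ∈-tabulate-does⁺ {x} qx =
    lookup⇒[]= x _ (trans (lookup∘tabulate (does ∘ Q?) x) (dec-true (Q? x) qx))

  ∈-tabulate-does⁻ : ∀ {x} → x ∈ tabulate (does ∘ Q?) → Q x
  ∈-tabulate-does⁻ {x} x∈
    with Q? x | trans (sym (lookup∘tabulate (does ∘ Q?) x)) ([]=⇒lookup x∈)
  ... | yes qx | _  = qx
  ... | no _   | ()

⁅⁆-injective : ∀ {n} {a b : Fin n} → ⁅ a ⁆ ≡ ⁅ b ⁆ → a ≡ b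
⁅⁆-injective {a = a} {b} eq = x∈⁅y⁆⇒x≡y b (subst (a ∈_) eq (x∈⁅x⁆ a))

⁅⁆≢⊥ : ∀ {n} {a : Fin n} → ⁅ a ⁆ ≢ ⊥
⁅⁆≢⊥ {a = a} eq = ∉⊥ (subst (a ∈_) eq (x∈⁅x⁆ a))

∈⇒≢⊥ : ∀ {n} {A : Subset n} {a} → a ∈ A → A ≢ ⊥
∈⇒≢⊥ a∈A refl = ∉⊥ a∈A

⁅⁆-all : ∀ {n} {Q : Fin n → Set} {a} → Q a → ∀ x → x ∈ ⁅ a ⁆ → Q x
⁅⁆-all {Q = Q} {a} qa x x∈⁅a⁆ = subst Q (sym (x∈⁅y⁆⇒x≡y a x∈⁅a⁆)) qa

module _ {n : ℕ} (P : FinBoundedPoset n) where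
  open FinBoundedPoset P
  open IsPartialOrder isPartialOrder
    using (antisym) renaming (refl to ≼-refl; trans to ≼-trans)

  ∈-ideal⁺ : ∀ {A x a} → a ∈ A → x ≼ a → x ∈ ideal P A
  ∈-ideal⁺ {A} {a = a} a∈A x≼a =
    ∈-tabulate-does⁺ (λ p → any? λ a → (a ∈? A) ×-dec (p ≼? a)) (a , a∈A , x≼a)

  ∈-ideal⁻ : ∀ {A x} → x ∈ ideal P A → ∃[ a ] (a ∈ A × x ≼ a)
  ∈-ideal⁻ {A} = ∈-tabulate-does⁻ (λ p → any? λ a → (a ∈? A) ×-dec (p ≼? a))

  ∈-filter⁺ : ∀ {A x a} → a ∈ A → a ≼ x → x ∈ filter P A
  ∈-filter⁺ {A} {a = a} a∈A a≼x =
    ∈-tabulate-does⁺ (λ p → any? λ a → (a ∈? A) ×-dec (a ≼? p)) (a , a∈A , a≼x)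

  ∈-filter⁻ : ∀ {A x} → x ∈ filter P A → ∃[ a ] (a ∈ A × a ≼ x)
  ∈-filter⁻ {A} = ∈-tabulate-does⁻ (λ p → any? λ a → (a ∈? A) ×-dec (a ≼? p))

  IsMaximal : Subset n → Fin n → Set
  IsMaximal Q p = p ∈ Q × (∀ q → ¬ (q ∈ Q × (p ≼ q × p ≢ q)))

  ∈-maxOf⁺ : ∀ {Q p} → IsMaximal Q p → p ∈ maxOf P Q
  ∈-maxOf⁺ {Q} = ∈-tabulate-does⁺
    (λ p → (p ∈? Q) ×-dec all? (λ q → ¬? ((q ∈? Q) ×-dec ((p ≼? q) ×-dec ¬? (p ≟ q)))))

  ∈-maxOf⁻ : ∀ {Q p} → p ∈ maxOf P Q → IsMaximal Q p
  ∈-maxOf⁻ {Q} = ∈-tabulate-does⁻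
    (λ p → (p ∈? Q) ×-dec all? (λ q → ¬? ((q ∈? Q) ×-dec ((p ≼? q) ×-dec ¬? (p ≟ q)))))

  maxOf⊆ : ∀ {Q} → maxOf P Q ⊆ Q
  maxOf⊆ = proj₁ ∘ ∈-maxOf⁻

  maxOf-isAntichain : ∀ Q → IsAntichain P (maxOf P Q)
  maxOf-isAntichain Q a b a∈ b∈ a≼b with a ≟ b
  ... | yes a≡b = a≡b
  ... | no a≢b  = contradiction (maxOf⊆ b∈ , a≼b , a≢b) (proj₂ (∈-maxOf⁻ a∈) b)

  maxOf-above : ∀ {Q q} → q ∈ Q → ∃[ c ] (c ∈ maxOf P Q × q ≼ c)
  maxOf-above {Q} {q} = climb (po-noetherian isPartialOrder q)
    where
    climb : ∀ {q} → Acc (λ x y → y ≼ x × y ≢ x) q → q ∈ Q → ∃[ c ] (c ∈ maxOf P Q × q ≼ c)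
    climb {q} (acc above) q∈Q with any? (λ q′ → (q′ ∈? Q) ×-dec ((q ≼? q′) ×-dec ¬? (q ≟ q′)))
    ... | no q-maximal = q , ∈-maxOf⁺ (q∈Q , λ q′ h → q-maximal (q′ , h)) , ≼-refl
    ... | yes (q′ , q′∈Q , q≺q′) with climb (above q≺q′) q′∈Q
    ...   | c , c∈ , q′≼c = c , c∈ , ≼-trans (proj₁ q≺q′) q′≼c

  ⁅⁆-isAntichain : ∀ x → IsAntichain P ⁅ x ⁆
  ⁅⁆-isAntichain x a b a∈ b∈ _ = trans (x∈⁅y⁆⇒x≡y x a∈) (sym (x∈⁅y⁆⇒x≡y x b∈))

  ∈-ideal-⁅⁆⁻ : ∀ {x a} → x ∈ ideal P ⁅ a ⁆ → x ≼ a
  ∈-ideal-⁅⁆⁻ {x} {a} x∈ with ∈-ideal⁻ x∈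
  ... | c , c∈ , x≼c = subst (x ≼_) (x∈⁅y⁆⇒x≡y a c∈) x≼c

  ⁅⁆-mono-≤△ : ∀ {a a′} → a ≼ a′ → _≤△_ P ⁅ a ⁆ ⁅ a′ ⁆
  ⁅⁆-mono-≤△ a≼a′ x∈ = ∈-ideal⁺ (x∈⁅x⁆ _) (≼-trans (∈-ideal-⁅⁆⁻ x∈) a≼a′)

  ⁅𝟘⁆-≤△ : ∀ {A a} → a ∈ A → _≤△_ P ⁅ 𝟘 ⁆ A
  ⁅𝟘⁆-≤△ {a = a} a∈A x∈ = ∈-ideal⁺ a∈A (≼-trans (∈-ideal-⁅⁆⁻ x∈) (𝟘-least a))

  maxOf-mono-≤△ : ∀ {Q Q′} → Q ⊆ Q′ → _≤△_ P (maxOf P Q) (maxOf P Q′)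
  maxOf-mono-≤△ Q⊆Q′ x∈ with ∈-ideal⁻ x∈
  ... | c , c∈ , x≼c with maxOf-above (Q⊆Q′ (maxOf⊆ c∈))
  ...   | c′ , c′∈ , c≼c′ = ∈-ideal⁺ c′∈ (≼-trans x≼c c≼c′)

  ∧△-monoʳ-≤△ : ∀ {B A A′} → _≤△_ P A A′ → _≤△_ P (_∧△_ P B A) (_∧△_ P B A′)
  ∧△-monoʳ-≤△ {B} {A} A≤A′ = maxOf-mono-≤△ λ x∈ →
    let x∈IB , x∈IA = x∈p∩q⁻ (ideal P B) (ideal P A) x∈ in x∈p∩q⁺ (x∈IB , A≤A′ x∈IA)

  antichain-∋𝟘 : ∀ {A} → IsAntichain P A → 𝟘 ∈ A → A ≡ ⁅ 𝟘 ⁆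
  antichain-∋𝟘 {A} anti 𝟘∈A = ⊆-antisym
    (λ {x} x∈A → subst (_∈ ⁅ 𝟘 ⁆) (anti 𝟘 x 𝟘∈A x∈A (𝟘-least x)) (x∈⁅x⁆ 𝟘))
    (λ x∈⁅𝟘⁆ → subst (_∈ A) (sym (x∈⁅y⁆⇒x≡y 𝟘 x∈⁅𝟘⁆)) 𝟘∈A)

  antichain-≢⁅𝟘⁆-∌𝟘 : ∀ {A a} → IsAntichain P A → A ≢ ⁅ 𝟘 ⁆ → a ∈ A → a ≢ 𝟘
  antichain-≢⁅𝟘⁆-∌𝟘 anti A≢⁅𝟘⁆ a∈A refl = A≢⁅𝟘⁆ (antichain-∋𝟘 anti a∈A)

  ≤▽-below : ∀ {A′ A″ a} → _≤▽_ P A′ A″ → a ∈ A′ → ∃[ a″ ] (a″ ∈ A″ × a″ ≼ a)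
  ≤▽-below A′≤A″ a∈A′ = ∈-filter⁻ (A′≤A″ (∈-filter⁺ a∈A′ ≼-refl))

  module _ (ω : Subset n → ℤ) where

    blockingRatio : Fin n → Fin n → ℚ
    blockingRatio b a = ω (_∧△_ P ⁅ b ⁆ ⁅ a ⁆) /ℤ ω ⁅ b ⁆

    RelBlocking-nontrivial⇔ : ∀ {r A b} → IsAntichain P A → A ≢ ⊥ → A ≢ ⁅ 𝟘 ⁆ →
      RelBlocking P ω r A b ⇔ (b ≢ 𝟘 × (∀ a → a ∈ A → r ℚ.< blockingRatio b a))
    RelBlocking-nontrivial⇔ {r} {A} {b} anti A≢⊥ A≢⁅𝟘⁆ = mk⇔ to from
      where
      to : RelBlocking P ω r A b → b ≢ 𝟘 × (∀ a → a ∈ A → r ℚ.< blockingRatio b a)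
      to (inj₁ A≡⊥)                   = contradiction A≡⊥ A≢⊥
      to (inj₂ (_ , _ , b≢𝟘 , blocks)) =
        b≢𝟘 , λ a a∈A → blocks a a∈A (antichain-≢⁅𝟘⁆-∌𝟘 anti A≢⁅𝟘⁆ a∈A)
      from : b ≢ 𝟘 × (∀ a → a ∈ A → r ℚ.< blockingRatio b a) → RelBlocking P ω r A b
      from (b≢𝟘 , blocks) = inj₂ (A≢⊥ , A≢⁅𝟘⁆ , b≢𝟘 , λ a a∈A _ → blocks a a∈A)

    RelBlocking-⁅⁆⇔ : ∀ {r a b} → a ≢ 𝟘 →
      RelBlocking P ω r ⁅ a ⁆ b ⇔ (b ≢ 𝟘 × r ℚ.< blockingRatio b a)
    RelBlocking-⁅⁆⇔ {r} {a} {b} a≢𝟘 = mk⇔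
      (λ blocking → let b≢𝟘 , blocks = to blocking in b≢𝟘 , blocks a (x∈⁅x⁆ a))
      (λ (b≢𝟘 , r<ρ) → from (b≢𝟘 , ⁅⁆-all r<ρ))
      where
      open Equivalence (RelBlocking-nontrivial⇔ {r} {⁅ a ⁆} {b}
        (⁅⁆-isAntichain a) ⁅⁆≢⊥ (a≢𝟘 ∘ ⁅⁆-injective))

    RelBlocking-⋂ : ∀ {r A} → IsAntichain P A → A ≢ ⊥ → A ≢ ⁅ 𝟘 ⁆ → ∀ b →
      RelBlocking P ω r A b ⇔ (∀ a → a ∈ A → RelBlocking P ω r ⁅ a ⁆ b)
    RelBlocking-⋂ {r} {A} anti A≢⊥ A≢⁅𝟘⁆ b = mk⇔
      (λ blocking a a∈A → let b≢𝟘 , blocks = A.to blocking in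
        Equivalence.from (⁅a⁆⇔ a∈A) (b≢𝟘 , blocks a a∈A))
      λ blocking → A.from
        (b≢𝟘 blocking , λ a a∈A → proj₂ (Equivalence.to (⁅a⁆⇔ a∈A) (blocking a a∈A)))
      where
      module A = Equivalence (RelBlocking-nontrivial⇔ {r} {A} {b} anti A≢⊥ A≢⁅𝟘⁆)
      ⁅a⁆⇔ : ∀ {a} → a ∈ A → RelBlocking P ω r ⁅ a ⁆ b ⇔ (b ≢ 𝟘 × r ℚ.< blockingRatio b a)
      ⁅a⁆⇔ a∈A = RelBlocking-⁅⁆⇔ (antichain-≢⁅𝟘⁆-∌𝟘 anti A≢⁅𝟘⁆ a∈A)
      b≢𝟘 : (∀ a → a ∈ A → RelBlocking P ω r ⁅ a ⁆ b) → b ≢ 𝟘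
      b≢𝟘 blocking with nonempty? A
      ... | yes (a , a∈A) = proj₁ (Equivalence.to (⁅a⁆⇔ a∈A) (blocking a a∈A))
      ... | no A-empty    = contradiction (Empty-unique A-empty) A≢⊥

    RelBlocking-antitoneʳ : ∀ {r′ r″ A b} → r′ ℚ.≤ r″ →
      RelBlocking P ω r″ A b → RelBlocking P ω r′ A b
    RelBlocking-antitoneʳ _      (inj₁ A≡⊥) = inj₁ A≡⊥
    RelBlocking-antitoneʳ r′≤r″ (inj₂ (A≢⊥ , A≢⁅𝟘⁆ , b≢𝟘 , blocks)) =
      inj₂ (A≢⊥ , A≢⁅𝟘⁆ , b≢𝟘 , λ a a∈A a≢𝟘 → ℚₚ.≤-<-trans r′≤r″ (blocks a a∈A a≢𝟘))

    module _ (adm : Admissible P ω) where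
      open Admissible adm

      ω-mono-pos : ∀ {A′ A″} → IsAntichain P A′ → IsAntichain P A″ → _≤△_ P A′ A″ →
        + 0 ℤ.< ω A′ → ω A′ ℤ.≤ ω A″
      ω-mono-pos {A′} {A″} anti′ anti″ A′≤A″ 0<ωA′ with nonempty? A′
      ... | no A′-empty with refl ← Empty-unique A′-empty =
        contradiction (subst (+ 0 ℤ.<_) ω-empty 0<ωA′) λ ()
      ... | yes (a , a∈A′) = proj₂ (ω-mono A′ A″ anti′ anti″ (⁅𝟘⁆-≤△ a∈A′) A′≢⁅𝟘⁆ A′≤A″)
        where
        A′≢⁅𝟘⁆ : A′ ≢ ⁅ 𝟘 ⁆
        A′≢⁅𝟘⁆ refl = ℤₚ.<-irrefl (sym ω-zero) 0<ωA′

      ω-⁅⁆-pos : ∀ {b} → b ≢ 𝟘 → + 0 ℤ.< ω ⁅ b ⁆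
      ω-⁅⁆-pos {b} b≢𝟘 = proj₁ (ω-mono ⁅ b ⁆ ⁅ b ⁆ (⁅⁆-isAntichain b) (⁅⁆-isAntichain b)
        (⁅𝟘⁆-≤△ (x∈⁅x⁆ b)) (b≢𝟘 ∘ ⁅⁆-injective) ⊆-refl)

      blockingRatio-mono : ∀ {r b a a′} → ℚ.0ℚ ℚ.≤ r → b ≢ 𝟘 → a ≼ a′ →
        r ℚ.< blockingRatio b a → r ℚ.< blockingRatio b a′
      blockingRatio-mono {r} {b} 0≤r b≢𝟘 a≼a′ r<ρ =
        ℚₚ.<-≤-trans r<ρ (/ℤ-monoˡ-≤ 0<ωb ω-mono-meet)
        where
        0<ωb = ω-⁅⁆-pos b≢𝟘
        ω-mono-meet = ω-mono-pos (maxOf-isAntichain _) (maxOf-isAntichain _)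
          (∧△-monoʳ-≤△ (⁅⁆-mono-≤△ a≼a′)) (/ℤ-pos⁻¹ 0<ωb (ℚₚ.≤-<-trans 0≤r r<ρ))

      RelBlocking-antitone-≤▽ : ∀ {r A′ A″} → ℚ.0ℚ ℚ.≤ r → IsAntichain P A″ → _≤▽_ P A′ A″ →
        ∀ b → RelBlocking P ω r A″ b → RelBlocking P ω r A′ b
      RelBlocking-antitone-≤▽ _ _ A′≤⊥ _ (inj₁ refl) =
        inj₁ (Empty-unique λ (a , a∈A′) → ∉⊥ (proj₁ (proj₂ (≤▽-below A′≤⊥ a∈A′))))
      RelBlocking-antitone-≤▽ {r} {A′} {A″} 0≤r anti″ A′≤A″ b
        (inj₂ (_ , A″≢⁅𝟘⁆ , b≢𝟘 , blocks)) with nonempty? A′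
      ... | no A′-empty = inj₁ (Empty-unique A′-empty)
      ... | yes (a₀ , a₀∈A′) = inj₂ (∈⇒≢⊥ a₀∈A′ , A′≢⁅𝟘⁆ , b≢𝟘 , blocks′)
        where
        ∌𝟘 : ∀ {a″} → a″ ∈ A″ → a″ ≢ 𝟘
        ∌𝟘 = antichain-≢⁅𝟘⁆-∌𝟘 anti″ A″≢⁅𝟘⁆
        A′≢⁅𝟘⁆ : A′ ≢ ⁅ 𝟘 ⁆
        A′≢⁅𝟘⁆ refl = let a″ , a″∈A″ , a″≼𝟘 = ≤▽-below A′≤A″ (x∈⁅x⁆ 𝟘) in
          ∌𝟘 a″∈A″ (antisym a″≼𝟘 (𝟘-least a″))
        blocks′ : ∀ a → a ∈ A′ → a ≢ 𝟘 → r ℚ.< blockingRatio b a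
        blocks′ a a∈A′ _ = let a″ , a″∈A″ , a″≼a = ≤▽-below A′≤A″ a∈A′ in
          blockingRatio-mono 0≤r b≢𝟘 a″≼a (blocks a″ a″∈A″ (∌𝟘 a″∈A″))

proposition2p3 : (n : ℕ) → 1 ℕ.< n → (P : FinBoundedPoset n) →
    (ω : Subset n → ℤ) → Admissible P ω →
    (r : ℚ) → ℚ.0ℚ ℚ.≤ r → r ℚ.< ℚ.1ℚ →
    ((A : Subset n) → IsAntichain P A → A ≢ ⊥ → A ≢ ⁅ FinBoundedPoset.𝟘 P ⁆ →
      (b : Fin n) → RelBlocking P ω r A b ⇔ (∀ a → a ∈ A → RelBlocking P ω r ⁅ a ⁆ b))
    × ((A′ A″ : Subset n) → IsAntichain P A′ → IsAntichain P A″ → _≤▽_ P A′ A″ →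
      (b : Fin n) → RelBlocking P ω r A″ b → RelBlocking P ω r A′ b)
    × ((r′ r″ : ℚ) → ℚ.0ℚ ℚ.≤ r′ → r′ ℚ.≤ r″ → r″ ℚ.< ℚ.1ℚ →
      (A : Subset n) → IsAntichain P A →
      (b : Fin n) → RelBlocking P ω r″ A b → RelBlocking P ω r′ A b)
proposition2p3 _ _ P ω adm _ 0≤r _ =
  (λ _ anti A≢⊥ A≢⁅𝟘⁆ → RelBlocking-⋂ P ω anti A≢⊥ A≢⁅𝟘⁆) ,
  (λ _ _ _ anti″ A′≤A″ → RelBlocking-antitone-≤▽ P ω adm 0≤r anti″ A′≤A″) ,
  (λ _ _ _ r′≤r″ _ _ _ _ → RelBlocking-antitoneʳ P ω r′≤r″)
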